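{- Let $S=\{s_1,\dots,s_t\}$ with $t\ge 3$, $1<s_1<s_2<\dots<s_t$ integers and $\gcd(s_1,\dots,s_t)=1$, and let $\mathbb{S}=\langle S\rangle$ with Frobenius number $F(\mathbb{S})$. Then $S$ is greedy if and only if $S$ has no witness $k$ with $s_3+s_1+2\le k\le F(\mathbb{S})+s_t+s_{t-1}$.
   Context: $\langle S\rangle=\{\sum_i a_i s_i : a_i\in\mathbb{N}_0\}$; $F(\mathbb{S})$ is the largest integer not in $\mathbb{S}$. A representation of $k\in\langle S\rangle$ is a vector $(a_1,\dots,a_t)\in\mathbb{N}_0^t$ with $\sum_i a_i s_i=k$; its cost is $\sum_i a_i$; $\mathrm{MinCost}_S(k)$ is the minimum cost over all representations. The (generalized) greedy representation of $k\in\langle S\rangle$, $k>0$: set $r:=k$; for $i=t,\dots,1$ let $a_i$ be the largest integer $q\ge0$ with $r-qs_i\in\langle S\rangle$ and replace $r$ by $r-a_is_i$; $\mathrm{GreedyCost}_S(k)=\sum_i a_i$ (with $\mathrm{GreedyCost}_S(0)=0$). $S$ is greedy if $\mathrm{GreedyCost}_S(k)=\mathrm{MinCost}_S(k)$ for all $k\in\langle S\rangle$, $k>0$. A witness for $S$ is an integer $k>0$, $k\in\langle S\rangle$, such that for some generator $s_i<k$ with $k-s_i\in\langle S\rangle$ one has $\mathrm{GreedyCost}_S(k)>\mathrm{GreedyCost}_S(k-s_i)+1$. -}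

module Defs where

open import Data.Nat using (ℕ; zero; suc; _+_; _*_; _∸_; _≤_; _<_)
open import Data.Nat.GCD using (gcd)
open import Data.Fin as Fin using (Fin)
open import Data.Vec using (Vec; lookup; zipWith; toList; foldr; sum)
open import Data.List as List using (List; []; _∷_; reverse)
open import Data.Product using (Σ; ∃; _×_; _,_)
open import Relation.Nullary using (¬_)
open import Relation.Binary.PropositionalEquality using (_≡_)

dot : ∀ {t} → Vec ℕ t → Vec ℕ t → ℕ
dot a s = sum (zipWith _*_ a s)

InS : ∀ {t} → Vec ℕ t → ℕ → Set
InS {t} s k = Σ (Vec ℕ t) λ a → dot a s ≡ k

gcdV : ∀ {t} → Vec ℕ t → ℕ
gcdV = foldr _ gcd 0

IsFrobenius : ∀ {t} → Vec ℕ t → ℕ → Set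
IsFrobenius s f = ¬ InS s f × (∀ m → f < m → InS s m)

IsMinCost : ∀ {t} → Vec ℕ t → ℕ → ℕ → Set
IsMinCost {t} s k c =
  (Σ (Vec ℕ t) λ a → dot a s ≡ k × sum a ≡ c)
  × (∀ (a : Vec ℕ t) → dot a s ≡ k → c ≤ sum a)

-- Greedy run relative to a membership predicate M (that of ⟨S⟩):
-- GreedyRun M gs r c : processing the generators gs (in the given order)
-- starting with remainder r, choosing at each step the largest q ≥ 0
-- with r - q·g ∈ ⟨S⟩, yields total cost c.
data GreedyRun (M : ℕ → Set) : List ℕ → ℕ → ℕ → Set where
  done : ∀ {r} → GreedyRun M [] r 0
  step : ∀ {g gs r c} (q : ℕ) →
         q * g ≤ r → M (r ∸ q * g) →
         (∀ q′ → q < q′ → q′ * g ≤ r → ¬ M (r ∸ q′ * g)) →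
         GreedyRun M gs (r ∸ q * g) c →
         GreedyRun M (g ∷ gs) r (q + c)

IsGreedyCost : ∀ {t} → Vec ℕ t → ℕ → ℕ → Set
IsGreedyCost s k c = GreedyRun (InS s) (reverse (toList s)) k c

IsGreedy : ∀ {t} → Vec ℕ t → Set
IsGreedy s = ∀ k → InS s k → 0 < k → ∀ c → IsGreedyCost s k c → IsMinCost s k c

Witness : ∀ {t} → Vec ℕ t → ℕ → Set
Witness {t} s k =
  InS s k × 0 < k ×
  (Σ (Fin t) λ i →
     lookup s i < k × InS s (k ∸ lookup s i) ×
     (Σ ℕ λ c → Σ ℕ λ c′ →
        IsGreedyCost s k c × IsGreedyCost s (k ∸ lookup s i) c′ × c′ + 1 < c))

{-# OPTIONS --safe #-}
module Submission where

-- The greedy run of the definition (largest generator first, each with maximal multiplicity)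
-- costs one more than the run from k ∸ g, where g is the largest generator removable from k
-- inside ⟨S⟩. If S has no witness at all, greedy cost grows by at most one per removed generator,
-- so by induction on k it is at most the cost of any representation; conversely a witness
-- contradicts minimality. Above
-- F + s_t + s_{t-1}, s_t is removable both from a witness k and from k ∸ sᵢ, so both greedy runs
-- start with s_t and k ∸ s_t is again a witness. Below s₃ + s₁ + 2, either the largest removable
-- generator is at least s₃ and leaves less than 2s₁, which has greedy cost at most 1, or only
-- s₁ and s₂ are removable, and an induction shows that removing s₂ never costs more than
-- removing s₁.

open import Defs
open import Data.Empty using (⊥-elim)
open import Data.Fin as Fin using (Fin; zero; suc; fromℕ; inject₁; toℕ)
import Data.Fin.Properties as Finₚ
open import Data.List using (List; []; _∷_; reverse)
open import Data.List.Membership.Propositional using (_∈_)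
open import Data.List.Properties using (unfold-reverse)
open import Data.List.Relation.Unary.All as All using (All; []; _∷_)
open import Data.List.Relation.Unary.AllPairs using (AllPairs; []; _∷_)
import Data.List.Relation.Unary.AllPairs.Properties as AllPairsₚ
open import Data.List.Relation.Unary.Any using (here; there)
open import Data.List.Relation.Unary.Any.Properties using (reverse⁺; reverse⁻)
open import Data.Nat
  using (ℕ; zero; suc; _+_; _*_; _∸_; _≤_; _<_; _>_; _≤?_; z≤n; s≤s; z<s; s≤s⁻¹; s<s⁻¹; >-nonZero)
open import Data.Nat.Induction using (<-wellFounded)
open import Data.Nat.Properties
open import Data.Sum using (_⊎_; inj₁; inj₂)
open import Data.Product using (Σ; ∃; _×_; _,_; proj₁; proj₂; uncurry)
open import Data.Vec using (Vec; []; _∷_; lookup; toList; sum; replicate; _[_]%=_)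
import Data.Vec.Membership.Propositional as VecMem
import Data.Vec.Membership.Propositional.Properties as VecMemₚ
import Data.Vec.Relation.Unary.Any as VecAny
open import Data.Vec.Relation.Unary.Any.Properties using (lookup-index)
open import Function using (_∘_; flip)
open import Function.Bundles using (_⇔_; mk⇔)
open import Induction.WellFounded using (Acc; acc)
open import Relation.Binary.Definitions using (tri<; tri≈; tri>)
open import Relation.Binary.PropositionalEquality
open import Relation.Nullary using (¬_; Dec; yes; no; contradiction)
open import Relation.Nullary.Decidable using (map′; _×-dec_)
open import Relation.Unary using (Decidable)

∸-comm : ∀ m n o → m ∸ n ∸ o ≡ m ∸ o ∸ n
∸-comm m n o = begin
  m ∸ n ∸ o   ≡⟨ ∸-+-assoc m n o ⟩
  m ∸ (n + o) ≡⟨ cong (m ∸_) (+-comm n o) ⟩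
  m ∸ (o + n) ≡⟨ ∸-+-assoc m o n ⟨
  m ∸ o ∸ n   ∎
  where open ≡-Reasoning

m+n<o⇒m<o∸n : ∀ m {n o} → m + n < o → m < o ∸ n
m+n<o⇒m<o∸n m = m+n≤o⇒m≤o∸n (suc m)

0<m∸n⇒n<m : ∀ {m n} → 0 < m ∸ n → n < m
0<m∸n⇒n<m pos = ≰⇒> λ m≤n → <-irrefl (sym (m≤n⇒m∸n≡0 m≤n)) pos

m∸n<m : ∀ {m n} → 0 < m → 0 < n → m ∸ n < m
m∸n<m {suc m} {suc n} _ _ = s≤s (m∸n≤m m n)

largestUpTo : ∀ {P : ℕ → Set} → Decidable P → P 0 → ∀ m →
              ∃ λ q → P q × (∀ {q′} → q < q′ → q′ ≤ m → ¬ P q′)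
largestUpTo P? p₀ zero = 0 , p₀ , λ q<q′ q′≤0 _ → <⇒≱ q<q′ q′≤0
largestUpTo {P} P? p₀ (suc m) with P? (suc m)
... | yes p = suc m , p , λ q<q′ q′≤1+m _ → <⇒≱ q<q′ q′≤1+m
... | no ¬p with largestUpTo P? p₀ m
...   | q , pq , max = q , pq , max′
  where
  max′ : ∀ {q′} → q < q′ → q′ ≤ suc m → ¬ P q′
  max′ q<q′ q′≤1+m with m≤n⇒m<n∨m≡n q′≤1+m
  ... | inj₁ q′≤m = max q<q′ (s≤s⁻¹ q′≤m)
  ... | inj₂ refl = ¬p

≤-penultimate : ∀ {m} (i : Fin (suc (suc m))) → i ≢ fromℕ (suc m) → i Fin.≤ inject₁ (fromℕ m)
≤-penultimate {m} i i≢last =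
  subst (toℕ i ≤_) (sym (Finₚ.toℕ-inject₁ (fromℕ m)))
        (s≤s⁻¹ (Finₚ.≤∧≢⇒< (Finₚ.≤fromℕ i) i≢last))

AllPairs-reverse : ∀ {A : Set} {R : A → A → Set} {xs} → AllPairs R xs → AllPairs (flip R) (reverse xs)
AllPairs-reverse {xs = []} [] = []
AllPairs-reverse {xs = x ∷ xs} (Rx ∷ pairs) rewrite unfold-reverse x xs =
  AllPairsₚ.++⁺ (AllPairs-reverse pairs) ([] ∷ [])
    (All.tabulate λ y∈ → All.lookup Rx (reverse⁻ y∈) ∷ [])

toList-increasing : ∀ {m} (v : Vec ℕ m) → (∀ i j → i Fin.< j → lookup v i < lookup v j) →
                    AllPairs _<_ (toList v)
toList-increasing [] _ = []
toList-increasing (x ∷ v) increasing =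
  All.tabulate (λ y∈ → head< (VecMemₚ.∈-toList⁻ y∈))
    ∷ toList-increasing v (λ i j i<j → increasing (suc i) (suc j) (s≤s i<j))
  where
  head< : ∀ {y} → y VecMem.∈ v → x < y
  head< y∈ = subst (x <_) (sym (lookup-index y∈)) (increasing zero (suc (VecAny.index y∈)) z<s)

dot-[]%=suc : ∀ {m} (a s : Vec ℕ m) i → dot (a [ i ]%= suc) s ≡ lookup s i + dot a s
dot-[]%=suc (x ∷ a) (y ∷ s) zero = +-assoc y (x * y) (dot a s)
dot-[]%=suc (x ∷ a) (y ∷ s) (suc i) = begin
  x * y + dot (a [ i ]%= suc) s  ≡⟨ cong (x * y +_) (dot-[]%=suc a s i) ⟩
  x * y + (lookup s i + dot a s) ≡⟨ +-assoc (x * y) (lookup s i) (dot a s) ⟨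
  x * y + lookup s i + dot a s   ≡⟨ cong (_+ dot a s) (+-comm (x * y) (lookup s i)) ⟩
  lookup s i + x * y + dot a s   ≡⟨ +-assoc (lookup s i) (x * y) (dot a s) ⟩
  lookup s i + (x * y + dot a s) ∎
  where open ≡-Reasoning

sum-[]%=suc : ∀ {m} (a : Vec ℕ m) i → sum (a [ i ]%= suc) ≡ suc (sum a)
sum-[]%=suc (x ∷ a) zero = refl
sum-[]%=suc (x ∷ a) (suc i) = trans (cong (x +_) (sum-[]%=suc a i)) (+-suc x (sum a))

0<lookup⇒≡[]%=suc : ∀ {m} (a : Vec ℕ m) i → 0 < lookup a i → ∃ λ a′ → a ≡ a′ [ i ]%= suc
0<lookup⇒≡[]%=suc (suc x ∷ a) zero _ = x ∷ a , refl
0<lookup⇒≡[]%=suc (x ∷ a) (suc i) pos with 0<lookup⇒≡[]%=suc a i pos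
... | a′ , refl = x ∷ a′ , refl

0<dot⇒0<lookup : ∀ {m} (a s : Vec ℕ m) → 0 < dot a s → ∃ λ i → 0 < lookup a i
0<dot⇒0<lookup [] [] ()
0<dot⇒0<lookup (zero ∷ a) (_ ∷ s) pos with 0<dot⇒0<lookup a s pos
... | i , posᵢ = suc i , posᵢ
0<dot⇒0<lookup (suc x ∷ a) (_ ∷ s) _ = zero , z<s

dot-replicate-0 : ∀ {m} (s : Vec ℕ m) → dot (replicate m 0) s ≡ 0
dot-replicate-0 [] = refl
dot-replicate-0 (_ ∷ s) = dot-replicate-0 s

sum-replicate-0 : ∀ m → sum (replicate m 0) ≡ 0
sum-replicate-0 zero = refl
sum-replicate-0 (suc m) = sum-replicate-0 m

sum*≤dot : ∀ {m} (a s : Vec ℕ m) {b} → (∀ i → b ≤ lookup s i) → sum a * b ≤ dot a s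
sum*≤dot [] [] _ = z≤n
sum*≤dot (x ∷ a) (y ∷ s) {b} b≤s = begin
  (x + sum a) * b     ≡⟨ *-distribʳ-+ b x (sum a) ⟩
  x * b + sum a * b   ≤⟨ +-mono-≤ (*-monoʳ-≤ x (b≤s zero)) (sum*≤dot a s (b≤s ∘ suc)) ⟩
  x * y + dot a s     ∎
  where open ≤-Reasoning

dot≡sum* : ∀ {m} (a s : Vec ℕ m) {b} → (∀ i → 0 < lookup a i → lookup s i ≡ b) → dot a s ≡ sum a * b
dot≡sum* [] [] _ = refl
dot≡sum* (zero ∷ a) (y ∷ s) sᵢ≡b = dot≡sum* a s (sᵢ≡b ∘ suc)
dot≡sum* (suc x ∷ a) (y ∷ s) {b} sᵢ≡b = begin
  suc x * y + dot a s     ≡⟨ cong₂ (λ u v → suc x * u + v) (sᵢ≡b zero z<s)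
                                   (dot≡sum* a s (sᵢ≡b ∘ suc)) ⟩
  suc x * b + sum a * b   ≡⟨ *-distribʳ-+ b (suc x) (sum a) ⟨
  (suc x + sum a) * b     ∎
  where open ≡-Reasoning

Removable : (ℕ → Set) → ℕ → ℕ → Set
Removable M r g = g ≤ r × M (r ∸ g)

Closed : (ℕ → Set) → ℕ → Set
Closed M g = ∀ {x} → M x → M (g + x)

module _ {M : ℕ → Set} where

  closed-* : ∀ {g} → Closed M g → ∀ q → Closed M (q * g)
  closed-* closed zero m = m
  closed-* {g} closed (suc q) {x} m = subst M (sym (+-assoc g (q * g) x)) (closed (closed-* closed q m))

  removable⇒member : ∀ {r g} → Closed M g → Removable M r g → M r
  removable⇒member closed (g≤r , m) = subst M (m+[n∸m]≡n g≤r) (closed m)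

  removable-∸⁻ : ∀ {r g x} → Removable M r (g + x) → Removable M (r ∸ g) x
  removable-∸⁻ {r} {g} {x} (g+x≤r , m) =
    m+n≤o⇒m≤o∸n x (subst (_≤ r) (+-comm g x) g+x≤r) , subst M (sym (∸-+-assoc r g x)) m

  removable-∸⁺ : ∀ {r g x} → g ≤ r → Removable M (r ∸ g) x → Removable M r (g + x)
  removable-∸⁺ {r} {g} {x} g≤r (x≤r∸g , m) =
    subst (_≤ r) (+-comm x g) (m≤o∸n⇒m+n≤o x g≤r x≤r∸g) , subst M (∸-+-assoc r g x) m

  removable-absorb : ∀ {r g x} → Closed M g → Removable M r (g + x) → Removable M r x
  removable-absorb {r} {g} {x} closed (g+x≤r , m) = ≤-trans (m≤n+m x g) g+x≤r , subst M eq (closed m)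
    where
    eq : g + (r ∸ (g + x)) ≡ r ∸ x
    eq = trans (sym (+-∸-assoc g g+x≤r)) ([m+n]∸[m+o]≡n∸o g r x)

  removable-after : ∀ {r g x} → Closed M g → g ≤ r → Removable M (r ∸ g) x → Removable M r x
  removable-after closed g≤r = removable-absorb closed ∘ removable-∸⁺ g≤r

  removable-swap : ∀ {r g x} → g ≤ r → Removable M (r ∸ g) x → Removable M (r ∸ x) g
  removable-swap {r} {g} {x} g≤r = removable-∸⁻ ∘ subst (Removable M r) (+-comm g x) ∘ removable-∸⁺ g≤r

  greedyRun-unique : ∀ {gs r c₁ c₂} → GreedyRun M gs r c₁ → GreedyRun M gs r c₂ → c₁ ≡ c₂
  greedyRun-unique done done = refl
  greedyRun-unique (step q₁ le₁ m₁ max₁ run₁) (step q₂ le₂ m₂ max₂ run₂) with <-cmp q₁ q₂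
  ... | tri< q₁<q₂ _ _ = ⊥-elim (max₁ q₂ q₁<q₂ le₂ m₂)
  ... | tri> _ _ q₂<q₁ = ⊥-elim (max₂ q₁ q₂<q₁ le₁ m₁)
  ... | tri≈ _ refl _ = cong (q₁ +_) (greedyRun-unique run₁ run₂)

  greedyRun-zero : ∀ {gs c} → All (0 <_) gs → GreedyRun M gs 0 c → c ≡ 0
  greedyRun-zero [] done = refl
  greedyRun-zero (_ ∷ pos) (step zero _ _ _ run) = greedyRun-zero pos run
  greedyRun-zero {g ∷ _} (0<g ∷ _) (step (suc q) [1+q]g≤0 _ _ _) =
    contradiction [1+q]g≤0 (<⇒≱ (<-≤-trans 0<g (m≤m+n g (q * g))))

  greedyRun-exists : Decidable M → ∀ {gs r} → All (0 <_) gs → M r → ∃ (GreedyRun M gs r)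
  greedyRun-exists M? [] _ = 0 , done
  greedyRun-exists M? {g ∷ _} {r} (0<g ∷ pos) m
    with largestUpTo (λ q → q * g ≤? r ×-dec M? (r ∸ q * g)) (z≤n , m) r
  ... | q , (qg≤r , m′) , max with greedyRun-exists M? pos m′
  ...   | c , run = q + c , step q qg≤r m′ max′ run
    where
    max′ : ∀ q′ → q < q′ → q′ * g ≤ r → ¬ M (r ∸ q′ * g)
    max′ q′ q<q′ q′g≤r = max q<q′ (≤-trans (m≤m*n q′ g {{>-nonZero 0<g}}) q′g≤r) ∘ (q′g≤r ,_)

  LargestRemovable : List ℕ → ℕ → ℕ → Set
  LargestRemovable gs r g =
    g ∈ gs × Removable M r g × (∀ {g′} → g′ ∈ gs → Removable M r g′ → g′ ≤ g)

  largestRemovable-exists : Decidable M → ∀ {gs r g} → AllPairs _>_ gs →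
                            g ∈ gs → Removable M r g → ∃ (LargestRemovable gs r)
  largestRemovable-exists M? {h ∷ _} {r} (h>hs ∷ descending) g∈ g-rem
    with h ≤? r ×-dec M? (r ∸ h) | g∈
  ... | yes h-rem | _ =
    h , here refl , h-rem , λ { (here refl) _ → ≤-refl ; (there g′∈) _ → <⇒≤ (All.lookup h>hs g′∈) }
  ... | no ¬h-rem | here refl = contradiction g-rem ¬h-rem
  ... | no ¬h-rem | there g∈hs with largestRemovable-exists M? descending g∈hs g-rem
  ...   | g₁ , g₁∈ , g₁-rem , g₁-max = g₁ , there g₁∈ , g₁-rem , g₁-max′
    where
    g₁-max′ : ∀ {g′} → g′ ∈ h ∷ _ → Removable M r g′ → g′ ≤ g₁
    g₁-max′ (here refl) h-rem = contradiction h-rem ¬h-rem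
    g₁-max′ (there g′∈) = g₁-max g′∈

  greedyRun-largest : ∀ {gs r g c} → All (Closed M) gs → AllPairs _>_ gs →
                      LargestRemovable gs r g → GreedyRun M gs r c →
                      ∃ λ c₀ → c ≡ suc c₀ × GreedyRun M gs (r ∸ g) c₀
  greedyRun-largest {h ∷ hs} {r} {g} closed (_ ∷ descending) (g∈ , g-rem@(g≤r , _) , largest)
                    (step zero _ _ max run) with g∈
  ... | here refl = contradiction (subst (Removable M r) (sym (*-identityˡ h)) g-rem) (uncurry (max 1 z<s))
  ... | there g∈hs with greedyRun-largest (All.tail closed) descending (g∈hs , g-rem , largest ∘ there) run
  ...   | c₀ , refl , run₀ = c₀ , refl , step 0 z≤n (proj₂ g-rem) max′ run₀
    where
    max′ : ∀ q′ → 0 < q′ → q′ * h ≤ r ∸ g → ¬ M (r ∸ g ∸ q′ * h)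
    max′ q′ 0<q′ q′h≤ m =
      uncurry (max q′ 0<q′) (removable-after (All.lookup closed g∈) g≤r (q′h≤ , m))
  greedyRun-largest {h ∷ hs} {r} (h-closed ∷ _) (h>hs ∷ _) (g∈ , _ , largest)
                    (step {c = c} (suc q₀) [1+q₀]h≤r m max run) with g∈
  ... | there g∈hs = contradiction (largest (here refl) h-rem) (<⇒≱ (All.lookup h>hs g∈hs))
    where
    h-rem : Removable M r h
    h-rem = removable-absorb (closed-* h-closed q₀)
              (subst (Removable M r) (+-comm h (q₀ * h)) ([1+q₀]h≤r , m))
  ... | here refl = q₀ + c , refl , step q₀ (proj₁ q₀h-rem) (proj₂ q₀h-rem) max′ run′
    where
    q₀h-rem : Removable M (r ∸ h) (q₀ * h)
    q₀h-rem = removable-∸⁻ {g = h} ([1+q₀]h≤r , m)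
    run′ : GreedyRun M hs (r ∸ h ∸ q₀ * h) c
    run′ = subst (λ x → GreedyRun M hs x c) (sym (∸-+-assoc r h (q₀ * h))) run
    max′ : ∀ q′ → q₀ < q′ → q′ * h ≤ r ∸ h → ¬ M (r ∸ h ∸ q′ * h)
    max′ q′ q₀<q′ q′h≤ m = uncurry (max (suc q′) (s≤s q₀<q′))
                                   (removable-∸⁺ (≤-trans (m≤m+n h (q₀ * h)) [1+q₀]h≤r) (q′h≤ , m))

module Generators {t} (s : Vec ℕ (suc t))
                  (increasing : ∀ (i j : Fin (suc t)) → i Fin.< j → lookup s i < lookup s j)
                  (0<s₁ : 0 < lookup s zero) where

  monotone : ∀ {i j} → i Fin.≤ j → lookup s i ≤ lookup s j
  monotone {i} {j} i≤j with i Fin.≟ j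
  ... | yes refl = ≤-refl
  ... | no i≢j = <⇒≤ (increasing i j (Finₚ.≤∧≢⇒< i≤j i≢j))

  positive : ∀ i → 0 < lookup s i
  positive i = <-≤-trans 0<s₁ (monotone {zero} {i} z≤n)

  ⟨S⟩ : ℕ → Set
  ⟨S⟩ = InS s

  0∈⟨S⟩ : ⟨S⟩ 0
  0∈⟨S⟩ = replicate _ 0 , dot-replicate-0 s

  +-closed : ∀ i → Closed ⟨S⟩ (lookup s i)
  +-closed i (a , refl) = a [ i ]%= suc , dot-[]%=suc a s i

  removable-coefficient : ∀ {k} a i → dot a s ≡ k → 0 < lookup a i → Removable ⟨S⟩ k (lookup s i)
  removable-coefficient a i refl 0<aᵢ with 0<lookup⇒≡[]%=suc a i 0<aᵢ
  ... | a′ , refl rewrite dot-[]%=suc a′ s i =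
    m≤m+n (lookup s i) (dot a′ s) , a′ , sym (m+n∸m≡n (lookup s i) (dot a′ s))

  ∈⟨S⟩⇒removable : ∀ {k} → ⟨S⟩ k → 0 < k → ∃ λ i → Removable ⟨S⟩ k (lookup s i)
  ∈⟨S⟩⇒removable (a , refl) 0<k with 0<dot⇒0<lookup a s 0<k
  ... | i , 0<aᵢ = i , removable-coefficient a i refl 0<aᵢ

  removable⇒∈⟨S⟩ : ∀ {k} → (∃ λ i → Removable ⟨S⟩ k (lookup s i)) → ⟨S⟩ k
  removable⇒∈⟨S⟩ (i , rem) = removable⇒member {M = ⟨S⟩} (+-closed i) rem

  ⟨S⟩? : Decidable ⟨S⟩
  ⟨S⟩? k = decide (<-wellFounded k)
    where
    decide : ∀ {k} → Acc _<_ k → Dec (⟨S⟩ k)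
    decide {zero} _ = yes 0∈⟨S⟩
    decide {suc k} (acc rec) =
      map′ removable⇒∈⟨S⟩ (λ m → ∈⟨S⟩⇒removable m z<s)
        (Finₚ.any? λ i → lookup s i ≤? suc k ×-dec decide (rec (m∸n<m z<s (positive i))))

  gens : List ℕ
  gens = reverse (toList s)

  ∈gens : ∀ i → lookup s i ∈ gens
  ∈gens i = reverse⁺ (VecMemₚ.∈-toList⁺ (VecMemₚ.∈-lookup i s))

  gens-index : ∀ {g} → g ∈ gens → ∃ λ i → lookup s i ≡ g
  gens-index {g} g∈ = VecAny.index v∈ , sym (lookup-index v∈)
    where
    v∈ : g VecMem.∈ s
    v∈ = VecMemₚ.∈-toList⁻ (reverse⁻ g∈)

  ∀gens : ∀ {P : ℕ → Set} → (∀ i → P (lookup s i)) → ∀ {g} → g ∈ gens → P g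
  ∀gens p g∈ with gens-index g∈
  ... | i , refl = p i

  gens-descending : AllPairs _>_ gens
  gens-descending = AllPairs-reverse (toList-increasing s increasing)

  LargestRemovableIndex : ℕ → Fin (suc t) → Set
  LargestRemovableIndex k i =
    Removable ⟨S⟩ k (lookup s i) × (∀ j → Removable ⟨S⟩ k (lookup s j) → lookup s j ≤ lookup s i)

  largestRemovableIndex-exists : ∀ {k} → ⟨S⟩ k → 0 < k → ∃ (LargestRemovableIndex k)
  largestRemovableIndex-exists k∈ 0<k with ∈⟨S⟩⇒removable k∈ 0<k
  ... | i , i-rem with largestRemovable-exists ⟨S⟩? gens-descending (∈gens i) i-rem
  ...   | g , g∈ , g-rem , g-max with gens-index g∈
  ...     | j , refl = j , g-rem , λ j′ → g-max (∈gens j′)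

  greedyCost-exists : ∀ {k} → ⟨S⟩ k → ∃ (IsGreedyCost s k)
  greedyCost-exists = greedyRun-exists ⟨S⟩? (All.tabulate (∀gens positive))

  greedyCost-zero : ∀ {c} → IsGreedyCost s 0 c → c ≡ 0
  greedyCost-zero = greedyRun-zero (All.tabulate (∀gens positive))

  greedyCost-largest : ∀ {k i c} → LargestRemovableIndex k i → IsGreedyCost s k c →
                       ∃ λ c₀ → c ≡ suc c₀ × IsGreedyCost s (k ∸ lookup s i) c₀
  greedyCost-largest {i = i} (i-rem , i-max) =
    greedyRun-largest (All.tabulate (∀gens +-closed)) gens-descending (∈gens i , i-rem , ∀gens i-max)

  greedyCost-representation : ∀ {k c} → ⟨S⟩ k → IsGreedyCost s k c →
                              Σ (Vec ℕ (suc t)) λ a → dot a s ≡ k × sum a ≡ c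
  greedyCost-representation {k} = go (<-wellFounded k)
    where
    go : ∀ {k c} → Acc _<_ k → ⟨S⟩ k → IsGreedyCost s k c →
         Σ (Vec ℕ (suc t)) λ a → dot a s ≡ k × sum a ≡ c
    go {zero} _ _ run =
      replicate _ 0 , dot-replicate-0 s , trans (sum-replicate-0 (suc t)) (sym (greedyCost-zero run))
    go {suc k} (acc rec) k∈ run with largestRemovableIndex-exists k∈ z<s
    ... | i , largest@((sᵢ≤k , k∸sᵢ∈) , _) with greedyCost-largest largest run
    ...   | c₀ , refl , run₀ with go (rec (m∸n<m z<s (positive i))) k∸sᵢ∈ run₀
    ...     | a , dot≡ , refl = a [ i ]%= suc , dot≡k , sum-[]%=suc a i
      where
      dot≡k : dot (a [ i ]%= suc) s ≡ suc k
      dot≡k = begin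
        dot (a [ i ]%= suc) s             ≡⟨ dot-[]%=suc a s i ⟩
        lookup s i + dot a s              ≡⟨ cong (lookup s i +_) dot≡ ⟩
        lookup s i + (suc k ∸ lookup s i) ≡⟨ m+[n∸m]≡n sᵢ≤k ⟩
        suc k                             ∎
        where open ≡-Reasoning

  greedyCost-positive : ∀ {k c} → ⟨S⟩ k → 0 < k → IsGreedyCost s k c → 0 < c
  greedyCost-positive k∈ 0<k run with largestRemovableIndex-exists k∈ 0<k
  ... | _ , largest with greedyCost-largest largest run
  ...   | _ , refl , _ = z<s

  greedyCost-generator : ∀ {i c} → IsGreedyCost s (lookup s i) c → c ≡ 1
  greedyCost-generator {i} run with greedyCost-largest (i-rem , λ _ → proj₁) run
    where
    i-rem : Removable ⟨S⟩ (lookup s i) (lookup s i)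
    i-rem = ≤-refl , subst ⟨S⟩ (sym (n∸n≡0 (lookup s i))) 0∈⟨S⟩
  ... | c₀ , refl , run₀ =
    cong suc (greedyCost-zero (subst (λ x → IsGreedyCost s x c₀) (n∸n≡0 (lookup s i)) run₀))

  greedyCost*s₁≤ : ∀ {k c} → ⟨S⟩ k → IsGreedyCost s k c → c * lookup s zero ≤ k
  greedyCost*s₁≤ k∈ run with greedyCost-representation k∈ run
  ... | a , refl , refl = sum*≤dot a s (λ i → monotone {zero} {i} z≤n)

  greedy⇒noWitness : IsGreedy s → ∀ k → ¬ Witness s k
  greedy⇒noWitness greedy k (k∈ , 0<k , i , sᵢ<k , k∸sᵢ∈ , c , c′ , run , run′ , c′+1<c)
    with proj₁ (greedy (k ∸ lookup s i) k∸sᵢ∈ (m<n⇒0<n∸m sᵢ<k) c′ run′)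
  ... | a , dot≡ , refl =
    <⇒≱ c′+1<c (subst (c ≤_) sum≡ (proj₂ (greedy k k∈ 0<k c run) (a [ i ]%= suc) dot≡k))
    where
    sum≡ : sum (a [ i ]%= suc) ≡ sum a + 1
    sum≡ = trans (sum-[]%=suc a i) (+-comm 1 (sum a))
    dot≡k : dot (a [ i ]%= suc) s ≡ k
    dot≡k = trans (dot-[]%=suc a s i) (trans (cong (lookup s i +_) dot≡) (m+[n∸m]≡n (<⇒≤ sᵢ<k)))

  noWitness⇒greedyCost-step : (∀ k → ¬ Witness s k) → ∀ {k i c c′} →
                              Removable ⟨S⟩ k (lookup s i) → IsGreedyCost s k c →
                              IsGreedyCost s (k ∸ lookup s i) c′ → c ≤ suc c′
  noWitness⇒greedyCost-step noWitness {k} {i} {c} {c′} i-rem@(sᵢ≤k , k∸sᵢ∈) run run′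
    with m≤n⇒m<n∨m≡n sᵢ≤k
  ... | inj₁ sᵢ<k = subst (c ≤_) (+-comm c′ 1) (≮⇒≥ λ c′+1<c → noWitness k
          (removable⇒∈⟨S⟩ (i , i-rem) , <-≤-trans (positive i) sᵢ≤k , i , sᵢ<k , k∸sᵢ∈ ,
           c , c′ , run , run′ , c′+1<c))
  ... | inj₂ refl = ≤-reflexive (trans (greedyCost-generator run) (cong suc (sym c′≡0)))
    where
    c′≡0 : c′ ≡ 0
    c′≡0 = greedyCost-zero (subst (λ x → IsGreedyCost s x c′) (n∸n≡0 (lookup s i)) run′)

  noWitness⇒greedyCost-minimal : (∀ k → ¬ Witness s k) → ∀ {k c} → IsGreedyCost s k c →
                                 ∀ a → dot a s ≡ k → c ≤ sum a
  noWitness⇒greedyCost-minimal noWitness {k} = go (<-wellFounded k)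
    where
    go : ∀ {k c} → Acc _<_ k → IsGreedyCost s k c → ∀ a → dot a s ≡ k → c ≤ sum a
    go {zero} _ run a _ = subst (_≤ sum a) (sym (greedyCost-zero run)) z≤n
    go {suc k} {c} (acc rec) run a dot≡ with 0<dot⇒0<lookup a s (subst (0 <_) (sym dot≡) z<s)
    ... | i , 0<aᵢ with 0<lookup⇒≡[]%=suc a i 0<aᵢ | removable-coefficient a i dot≡ 0<aᵢ
    ...   | a′ , refl | i-rem with greedyCost-exists (proj₂ i-rem)
    ...     | c′ , run′ = begin
      c                     ≤⟨ noWitness⇒greedyCost-step noWitness i-rem run run′ ⟩
      suc c′                ≤⟨ s≤s (go (rec (m∸n<m z<s (positive i))) run′ a′ dot-a′) ⟩
      suc (sum a′)          ≡⟨ sum-[]%=suc a′ i ⟨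
      sum (a′ [ i ]%= suc)  ∎
      where
      open ≤-Reasoning
      dot-a′ : dot a′ s ≡ suc k ∸ lookup s i
      dot-a′ = begin-equality
        dot a′ s                           ≡⟨ m+n∸m≡n (lookup s i) (dot a′ s) ⟨
        lookup s i + dot a′ s ∸ lookup s i ≡⟨ cong (_∸ lookup s i) (dot-[]%=suc a′ s i) ⟨
        dot (a′ [ i ]%= suc) s ∸ lookup s i ≡⟨ cong (_∸ lookup s i) dot≡ ⟩
        suc k ∸ lookup s i                 ∎

  noWitness⇒greedy : (∀ k → ¬ Witness s k) → IsGreedy s
  noWitness⇒greedy noWitness k k∈ _ c run =
    greedyCost-representation k∈ run , noWitness⇒greedyCost-minimal noWitness run

  greedyCost-top : ∀ {top k c} → (∀ i → lookup s i ≤ lookup s top) →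
                   Removable ⟨S⟩ k (lookup s top) → IsGreedyCost s k c →
                   ∃ λ c₀ → c ≡ suc c₀ × IsGreedyCost s (k ∸ lookup s top) c₀
  greedyCost-top top-max top-rem = greedyCost-largest (top-rem , λ j _ → top-max j)

  removable-above : ∀ {F m g} → (∀ m → F < m → ⟨S⟩ m) → F + g < m → Removable ⟨S⟩ m g
  removable-above {F} {m} {g} above-F F+g<m =
    ≤-trans (m≤n+m g F) (<⇒≤ F+g<m) , above-F _ (m+n<o⇒m<o∸n F F+g<m)

  witness-descent : ∀ {F b k} (top : Fin (suc t)) → (∀ m → F < m → ⟨S⟩ m) →
                    (∀ i → lookup s i ≤ lookup s top) → (∀ i → i ≢ top → lookup s i ≤ b) →
                    F + lookup s top + b < k → Witness s k → Witness s (k ∸ lookup s top)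
  witness-descent {F} {b} {k} top above-F top-max ≤b F+T+b<k
    (_ , _ , i , _ , _ , c , c′ , run , run′ , c′+1<c) with i Fin.≟ top
  ... | yes refl with greedyCost-top top-max (removable-above above-F (≤-<-trans (m≤m+n _ b) F+T+b<k)) run
  ...   | c₀ , refl , run₀ =
    ⊥-elim (<-irrefl (+-comm c₀ 1) (subst (λ x → x + 1 < suc c₀) (greedyRun-unique run′ run₀) c′+1<c))
  witness-descent {F} {b} {k} top above-F top-max ≤b F+T+b<k
    (_ , _ , i , _ , _ , c , c′ , run , run′ , c′+1<c) | no i≢top =
    descended (greedyCost-top top-max (removable-above above-F F+T<k) run)
              (greedyCost-top top-max (removable-above above-F F+T<k∸sᵢ) run′)
    where
    T = lookup s top
    F+T+sᵢ<k : F + T + lookup s i < k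
    F+T+sᵢ<k = ≤-<-trans (+-monoʳ-≤ (F + T) (≤b i i≢top)) F+T+b<k
    F+T<k : F + T < k
    F+T<k = ≤-<-trans (m≤m+n (F + T) _) F+T+sᵢ<k
    F+T<k∸sᵢ : F + T < k ∸ lookup s i
    F+T<k∸sᵢ = m+n<o⇒m<o∸n (F + T) F+T+sᵢ<k
    F<k∸T : F < k ∸ T
    F<k∸T = m+n<o⇒m<o∸n F F+T<k
    F<k∸T∸sᵢ : F < k ∸ T ∸ lookup s i
    F<k∸T∸sᵢ = subst (F <_) (∸-comm k (lookup s i) T) (m+n<o⇒m<o∸n F F+T<k∸sᵢ)
    descended : (∃ λ c₀ → c ≡ suc c₀ × IsGreedyCost s (k ∸ T) c₀) →
                (∃ λ c₁ → c′ ≡ suc c₁ × IsGreedyCost s (k ∸ lookup s i ∸ T) c₁) →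
                Witness s (k ∸ T)
    descended (c₀ , refl , run₀) (c₁ , refl , run₁) =
      above-F _ F<k∸T , <-≤-trans z<s F<k∸T ,
      i , 0<m∸n⇒n<m (<-≤-trans z<s F<k∸T∸sᵢ) , above-F _ F<k∸T∸sᵢ ,
      c₀ , c₁ , run₀ , subst (λ x → IsGreedyCost s x c₁) (∸-comm k (lookup s i) T) run₁ ,
      s<s⁻¹ c′+1<c

module WitnessWindow {n} (s : Vec ℕ (3 + n))
                      (increasing : ∀ (i j : Fin (3 + n)) → i Fin.< j → lookup s i < lookup s j)
                      (1<s₁ : 1 < lookup s zero) where

  open Generators s increasing (<-trans z<s 1<s₁)

  s₁ s₂ s₃ : ℕ
  s₁ = lookup s zero
  s₂ = lookup s (suc zero)
  s₃ = lookup s (suc (suc zero))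

  s₁<s₂ : s₁ < s₂
  s₁<s₂ = increasing zero (suc zero) z<s

  s₂<s₃ : s₂ < s₃
  s₂<s₃ = increasing (suc zero) (suc (suc zero)) (s≤s z<s)

  s₃≤ : ∀ j → s₃ ≤ lookup s (suc (suc j))
  s₃≤ j = monotone {suc (suc zero)} {suc (suc j)} (s≤s (s≤s z≤n))

  OnlyFirstTwoRemovable : ℕ → Set
  OnlyFirstTwoRemovable k = ∀ j → ¬ Removable ⟨S⟩ k (lookup s (suc (suc j)))

  onlyFirstTwo-∸ : ∀ {k} → OnlyFirstTwoRemovable k → ∀ i → lookup s i ≤ k →
                   OnlyFirstTwoRemovable (k ∸ lookup s i)
  onlyFirstTwo-∸ only i sᵢ≤k j = only j ∘ removable-after {M = ⟨S⟩} (+-closed i) sᵢ≤k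

  s₁-largest⇒greedyCost*s₁ : ∀ {x c} → LargestRemovableIndex x zero → ⟨S⟩ x →
                             IsGreedyCost s x c → x ≡ c * s₁
  s₁-largest⇒greedyCost*s₁ (_ , s₁-max) x∈ run with greedyCost-representation x∈ run
  ... | a , refl , refl = dot≡sum* a s λ i 0<aᵢ →
    ≤-antisym (s₁-max i (removable-coefficient a i refl 0<aᵢ)) (monotone {zero} {i} z≤n)

  largest-s₁-or-s₂ : ∀ {k} → OnlyFirstTwoRemovable k → ⟨S⟩ k → 0 < k →
                     LargestRemovableIndex k zero ⊎ LargestRemovableIndex k (suc zero)
  largest-s₁-or-s₂ only k∈ 0<k with largestRemovableIndex-exists k∈ 0<k
  ... | zero , largest = inj₁ largest
  ... | suc zero , largest = inj₂ largest
  ... | suc (suc j) , (j-rem , _) = ⊥-elim (only j j-rem)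

  greedyCost[k∸s₂]≤greedyCost[k∸s₁] :
    ∀ {k cy cx} → OnlyFirstTwoRemovable k → Removable ⟨S⟩ k s₁ → Removable ⟨S⟩ k s₂ →
    IsGreedyCost s (k ∸ s₂) cy → IsGreedyCost s (k ∸ s₁) cx → cy ≤ cx
  greedyCost[k∸s₂]≤greedyCost[k∸s₁] {k} = go (<-wellFounded k)
    where
    go : ∀ {k cy cx} → Acc _<_ k →
         OnlyFirstTwoRemovable k → Removable ⟨S⟩ k s₁ → Removable ⟨S⟩ k s₂ →
         IsGreedyCost s (k ∸ s₂) cy → IsGreedyCost s (k ∸ s₁) cx → cy ≤ cx
    go {k} {cy} {cx} (acc rec) only (s₁≤k , k∸s₁∈) (s₂≤k , k∸s₂∈) run-y run-x
      with largest-s₁-or-s₂ (onlyFirstTwo-∸ only zero s₁≤k) k∸s₁∈ (m<n⇒0<n∸m (<-≤-trans s₁<s₂ s₂≤k))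
    ... | inj₁ s₁-largest = <⇒≤ (*-cancelʳ-< s₁ cy cx (begin-strict
      cy * s₁  ≤⟨ greedyCost*s₁≤ k∸s₂∈ run-y ⟩
      k ∸ s₂   <⟨ ∸-monoʳ-< s₁<s₂ s₂≤k ⟩
      k ∸ s₁   ≡⟨ s₁-largest⇒greedyCost*s₁ s₁-largest k∸s₁∈ run-x ⟩
      cx * s₁  ∎))
      where open ≤-Reasoning
    ... | inj₂ s₂-largest with greedyCost-largest s₂-largest run-x
    ...   | cx₀ , refl , run-x₀ =
      after-s₂ (largest-s₁-or-s₂ only′ k∸s₂∈ (<-≤-trans (positive zero) (proj₁ s₁-rem)))
      where
      only′ : OnlyFirstTwoRemovable (k ∸ s₂)
      only′ = onlyFirstTwo-∸ only (suc zero) s₂≤k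
      s₁-rem : Removable ⟨S⟩ (k ∸ s₂) s₁
      s₁-rem = removable-swap {M = ⟨S⟩} s₁≤k (proj₁ s₂-largest)
      run-x₀′ : IsGreedyCost s (k ∸ s₂ ∸ s₁) cx₀
      run-x₀′ = subst (λ x → IsGreedyCost s x cx₀) (∸-comm k s₁ s₂) run-x₀
      after-s₂ : LargestRemovableIndex (k ∸ s₂) zero ⊎ LargestRemovableIndex (k ∸ s₂) (suc zero) →
                 cy ≤ suc cx₀
      after-s₂ (inj₁ s₁-largest) with greedyCost-largest s₁-largest run-y
      ... | cy₀ , refl , run-y₀ = ≤-reflexive (cong suc (greedyRun-unique run-y₀ run-x₀′))
      after-s₂ (inj₂ s₂-largest) with greedyCost-largest s₂-largest run-y
      ... | cy₀ , refl , run-y₀ =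
        s≤s (go (rec (m∸n<m (<-≤-trans (positive zero) s₁≤k) (positive (suc zero))))
                only′ s₁-rem (proj₁ s₂-largest) run-y₀ run-x₀′)

  greedyCost≤1 : ∀ {x c} → ⟨S⟩ x → x < s₁ + s₁ → IsGreedyCost s x c → c ≤ 1
  greedyCost≤1 {x} {c} x∈ x<2s₁ run = s≤s⁻¹ (*-cancelʳ-< s₁ c 2 (begin-strict
    c * s₁         ≤⟨ greedyCost*s₁≤ x∈ run ⟩
    x              <⟨ x<2s₁ ⟩
    s₁ + s₁        ≡⟨ cong (s₁ +_) (+-identityʳ s₁) ⟨
    2 * s₁         ∎))
    where open ≤-Reasoning

  largest-removal-cheapest : ∀ {k c₀ c′} i j → k < s₃ + s₁ + 2 →
                             lookup s i < k → ⟨S⟩ (k ∸ lookup s i) → LargestRemovableIndex k j →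
                             IsGreedyCost s (k ∸ lookup s j) c₀ → IsGreedyCost s (k ∸ lookup s i) c′ →
                             c₀ ≤ c′
  largest-removal-cheapest {k} i (suc (suc j)) k<bound sᵢ<k k∸sᵢ∈ ((_ , k∸sⱼ∈) , _) run₀ run′ =
    ≤-trans (greedyCost≤1 k∸sⱼ∈ k∸sⱼ<2s₁ run₀) (greedyCost-positive k∸sᵢ∈ (m<n⇒0<n∸m sᵢ<k) run′)
    where
    open ≤-Reasoning
    k∸sⱼ<2s₁ : k ∸ lookup s (suc (suc j)) < s₁ + s₁
    k∸sⱼ<2s₁ = begin-strict
      k ∸ lookup s (suc (suc j)) ≤⟨ ∸-monoʳ-≤ k (s₃≤ j) ⟩
      k ∸ s₃                     <⟨ m<n+o⇒m∸n<o k s₃ {{>-nonZero (<-≤-trans z<s (m≤n+m 2 s₁))}}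
                                                  (subst (k <_) (+-assoc s₃ s₁ 2) k<bound) ⟩
      s₁ + 2                     ≤⟨ +-monoʳ-≤ s₁ 1<s₁ ⟩
      s₁ + s₁                    ∎
  largest-removal-cheapest zero zero _ _ _ _ run₀ run′ = ≤-reflexive (greedyRun-unique run₀ run′)
  largest-removal-cheapest (suc zero) (suc zero) _ _ _ _ run₀ run′ = ≤-reflexive (greedyRun-unique run₀ run′)
  largest-removal-cheapest zero (suc zero) _ s₁<k k∸s₁∈ (s₂-rem , s₂-max) run₀ run′ =
    greedyCost[k∸s₂]≤greedyCost[k∸s₁] only (<⇒≤ s₁<k , k∸s₁∈) s₂-rem run₀ run′
    where
    only : OnlyFirstTwoRemovable _
    only j rem = <⇒≱ (<-≤-trans s₂<s₃ (s₃≤ j)) (s₂-max _ rem)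
  largest-removal-cheapest (suc i) zero _ sᵢ<k k∸sᵢ∈ (_ , s₁-max) _ _ =
    ⊥-elim (<⇒≱ (increasing zero (suc i) z<s) (s₁-max (suc i) (<⇒≤ sᵢ<k , k∸sᵢ∈)))
  largest-removal-cheapest (suc (suc i)) (suc zero) _ sᵢ<k k∸sᵢ∈ (_ , s₂-max) _ _ =
    ⊥-elim (<⇒≱ (<-≤-trans s₂<s₃ (s₃≤ i)) (s₂-max (suc (suc i)) (<⇒≤ sᵢ<k , k∸sᵢ∈)))

  witness-lower-bound : ∀ {k} → Witness s k → s₃ + s₁ + 2 ≤ k
  witness-lower-bound (k∈ , 0<k , i , sᵢ<k , k∸sᵢ∈ , c , c′ , run , run′ , c′+1<c)
    with largestRemovableIndex-exists k∈ 0<k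
  ... | j , largest with greedyCost-largest largest run
  ...   | c₀ , refl , run₀ = ≮⇒≥ λ k<bound → <⇒≱ c′+1<c (begin
    suc c₀   ≤⟨ s≤s (largest-removal-cheapest i j k<bound sᵢ<k k∸sᵢ∈ largest run₀ run′) ⟩
    suc c′   ≡⟨ +-comm 1 c′ ⟩
    c′ + 1   ∎)
    where open ≤-Reasoning

  last penultimate : Fin (3 + n)
  last = fromℕ (2 + n)
  penultimate = inject₁ (fromℕ (1 + n))

  noWitness-outside-window :
    ∀ {F} → (∀ m → F < m → ⟨S⟩ m) →
    (∀ k → s₃ + s₁ + 2 ≤ k → k ≤ F + lookup s last + lookup s penultimate → ¬ Witness s k) →
    ∀ k → ¬ Witness s k
  noWitness-outside-window {F} above-F window k = go (<-wellFounded k)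
    where
    go : ∀ {k} → Acc _<_ k → ¬ Witness s k
    go {k} (acc rec) w@(_ , 0<k , _) with k ≤? F + lookup s last + lookup s penultimate
    ... | yes k≤U = window k (witness-lower-bound w) k≤U w
    ... | no k≰U = go (rec (m∸n<m 0<k (positive last)))
                      (witness-descent last above-F (λ i → monotone (Finₚ.≤fromℕ i))
                                       (λ i i≢last → monotone (≤-penultimate i i≢last)) (≰⇒> k≰U) w)

theorem2 : (n : ℕ) (s : Vec ℕ (3 + n)) →
    1 < lookup s zero →
    (∀ (i j : Fin (3 + n)) → i Fin.< j → lookup s i < lookup s j) →
    gcdV s ≡ 1 →
    (F : ℕ) → IsFrobenius s F →
    IsGreedy s ⇔
      (∀ k → lookup s (suc (suc zero)) + lookup s zero + 2 ≤ k →
        k ≤ F + lookup s (fromℕ (2 + n)) + lookup s (inject₁ (fromℕ (1 + n))) →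
        ¬ Witness s k)
theorem2 n s 1<s₁ increasing _ F (_ , above-F) =
  mk⇔ (λ greedy k _ _ → greedy⇒noWitness greedy k)
      (noWitness⇒greedy ∘ noWitness-outside-window above-F)
  where
  open Generators s increasing (<-trans z<s 1<s₁)
  open WitnessWindow s increasing 1<s₁
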